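{- Let $\mathcal{G}_n$ be the set of all simple loopless undirected graphs on the vertex set $\{v_1,\dots,v_n\}$, and let $L:\mathcal{G}_n\to\mathcal{G}_n$ be an idempotent ($L\circ L=L$) linear operator that strongly preserves (a) the set of $(\mathbb{Z}_2,+)$-cordial graphs, where $n\ge 4$; or (b) the set of $(\mathbb{Z}_2,\times)$-cordial graphs, where $n\ge 4$; or (c) the set of $(2,3)$-orientable graphs, where $n\ge 6$. Then the image under $L$ of every graph consisting of exactly one edge is a graph consisting of exactly one edge.
   Context: $T:\mathcal{G}_n\to\mathcal{G}_n$ is a linear operator if $T(U\cup V)=T(U)\cup T(V)$ for all $U,V\in\mathcal{G}_n$ (union of edge sets) and $T$ maps the edgeless graph to the edgeless graph. $T$ preserves $\mathcal{X}\subseteq\mathcal{G}_n$ if $U\in\mathcal{X}\Rightarrow T(U)\in\mathcal{X}$, and strongly preserves $\mathcal{X}$ if it preserves both $\mathcal{X}$ and $\mathcal{G}_n\setminus\mathcal{X}$. A labeling of a finite set with labels in a finite set $\mathcal{A}$ is $\mathcal{A}$-friendly if the numbers of elements receiving any two labels differ by at most one; "friendly" means $\{0,1\}$-friendly. A graph $G=(V,E)$ is $(\mathbb{Z}_2,+)$-cordial (resp. $(\mathbb{Z}_2,\times)$-cordial) if there is a friendly $\{0,1\}$-labeling $f$ of the non-isolated vertices of $G$ such that the edge labeling $g(uv)=f(u)+f(v)\pmod 2$ (resp. $g(uv)=f(u)f(v)$) is a friendly labeling of $E$. A graph is $(2,3)$-orientable if there is an orientation of its edges and a friendly $\{0,1\}$-labeling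 $f$ of its non-isolated vertices such that the arc labeling $g(\overrightarrow{uv})=f(v)-f(u)\in\{ -1,0,1\}$ is $\mathbb{Z}_3$-friendly. -}

module Defs where

open import Data.Nat using (ℕ; zero; suc; _+_; _≤_)
open import Data.Bool using (Bool; true; false; _∧_; _∨_; _xor_; not; if_then_else_)
open import Data.Fin using (Fin; zero; suc; splitAt; _≟_)
open import Data.Sum using (_⊎_; inj₁; inj₂)
open import Data.Product using (_×_; _,_; proj₁; proj₂; Σ; ∃)
open import Data.Vec using (lookup)
open import Data.Fin.Subset using (Subset; _∪_; ⊥; ⁅_⁆)
open import Relation.Nullary using (¬_)
open import Relation.Nullary.Decidable using (⌊_⌋)
open import Relation.Binary.PropositionalEquality using (_≡_)

-- Number of possible edges on n vertices: numE n = n(n-1)/2.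
numE : ℕ → ℕ
numE zero = 0
numE (suc n) = n + numE n

-- Explicit enumeration of the unordered pairs {a,b}, a < b, of vertices
-- Fin n; each pair occurs exactly once.
ends : ∀ n → Fin (numE n) → Fin n × Fin n
ends zero ()
ends (suc n) e with splitAt n e
... | inj₁ i = zero , suc i
... | inj₂ e' = suc (proj₁ (ends n e')) , suc (proj₂ (ends n e'))

-- A simple loopless graph on vertex set Fin n = its edge set.
Graph : ℕ → Set
Graph n = Subset (numE n)

hasEdge : ∀ {n} → Graph n → Fin (numE n) → Bool
hasEdge G e = lookup G e

cnt : ∀ {m} → (Fin m → Bool) → ℕ
cnt {zero} p = 0
cnt {suc m} p = (if p zero then 1 else 0) + cnt (λ i → p (suc i))

anyF : ∀ {m} → (Fin m → Bool) → Bool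
anyF {zero} p = false
anyF {suc m} p = p zero ∨ anyF (λ i → p (suc i))

close : ℕ → ℕ → Set
close a b = (a ≤ suc b) × (b ≤ suc a)

nonIso : ∀ {n} → Graph n → Fin n → Bool
nonIso {n} G v = anyF (λ e → hasEdge {n} G e ∧
  (⌊ proj₁ (ends n e) ≟ v ⌋ ∨ ⌊ proj₂ (ends n e) ≟ v ⌋))

friendlyV : ∀ {n} → Graph n → (Fin n → Bool) → Set
friendlyV {n} G f = close (cnt (λ v → nonIso {n} G v ∧ not (f v)))
                      (cnt (λ v → nonIso {n} G v ∧ f v))

friendlyE : ∀ {n} → Graph n → (Fin (numE n) → Bool) → Set
friendlyE {n} G g = close (cnt (λ e → hasEdge {n} G e ∧ not (g e)))
                      (cnt (λ e → hasEdge {n} G e ∧ g e))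

-- (Z2,+)-cordial  (true = 1, false = 0; xor = addition mod 2)
Z2AddCordial : ∀ {n} → Graph n → Set
Z2AddCordial {n} G = ∃ λ (f : Fin n → Bool) → friendlyV {n} G f ×
  friendlyE {n} G (λ e → f (proj₁ (ends n e)) xor f (proj₂ (ends n e)))

-- (Z2,×)-cordial  (∧ = multiplication)
Z2MulCordial : ∀ {n} → Graph n → Set
Z2MulCordial {n} G = ∃ λ (f : Fin n → Bool) → friendlyV {n} G f ×
  friendlyE {n} G (λ e → f (proj₁ (ends n e)) ∧ f (proj₂ (ends n e)))

-- arc labels f(head) - f(tail) ∈ {-1,0,1}
data Lab : Set where
  neg zer pos : Lab

labEq : Lab → Lab → Bool
labEq neg neg = true
labEq zer zer = true
labEq pos pos = true
labEq _ _ = false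

diffLab : Bool → Bool → Lab   -- diffLab (f tail) (f head) = f head - f tail
diffLab false false = zer
diffLab true true = zer
diffLab false true = pos
diffLab true false = neg

-- orientation o e = true : arc from proj₁ (ends e) to proj₂ (ends e);
-- o e = false : the reverse arc.
arcLab : ∀ {n} → (Fin (numE n) → Bool) → (Fin n → Bool) → Fin (numE n) → Lab
arcLab {n} o f e with o e
... | true = diffLab (f (proj₁ (ends n e))) (f (proj₂ (ends n e)))
... | false = diffLab (f (proj₂ (ends n e))) (f (proj₁ (ends n e)))

cntLab : ∀ {n} → Graph n → (Fin (numE n) → Lab) → Lab → ℕ
cntLab {n} G g l = cnt (λ e → hasEdge {n} G e ∧ labEq (g e) l)

Orientable23 : ∀ {n} → Graph n → Set
Orientable23 {n} G = ∃ λ (o : Fin (numE n) → Bool) → ∃ λ (f : Fin n → Bool) →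
  friendlyV {n} G f ×
  close (cntLab {n} G (arcLab {n} o f) neg) (cntLab {n} G (arcLab {n} o f) zer) ×
  close (cntLab {n} G (arcLab {n} o f) zer) (cntLab {n} G (arcLab {n} o f) pos) ×
  close (cntLab {n} G (arcLab {n} o f) neg) (cntLab {n} G (arcLab {n} o f) pos)

IsLinear : ∀ {n} → (Graph n → Graph n) → Set
IsLinear T = (∀ U V → T (U ∪ V) ≡ T U ∪ T V) × (T ⊥ ≡ ⊥)

Idempotent : ∀ {n} → (Graph n → Graph n) → Set
Idempotent T = ∀ G → T (T G) ≡ T G

StronglyPreserves : ∀ {n} → (Graph n → Set) → (Graph n → Graph n) → Set
StronglyPreserves X T = (∀ G → X G → X (T G)) × (∀ G → ¬ X G → ¬ X (T G))

-- A linear operator L is monotone, and a strong preserver of a class Z cannot identify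
-- a graph in Z with one outside it. Call an edge f detected over a graph Y when adding f to Y
-- changes membership in Z; then L ⁅ f ⁆ ⊈ L Y. If some f ≠ e lay in L ⁅ e ⁆, idempotence would give
-- L ⁅ f ⁆ ⊆ L ⁅ e ⁆ ⊆ L Y for every Y containing e, so f would be detected over no such Y; and
-- if L ⁅ e ⁆ were empty, e could not be detected at all. Hence L ⁅ e ⁆ = ⁅ e ⁆ as soon as every
-- edge is detected over some graph, and every f ≠ e over some graph containing e. For the three
-- classes such graphs are copies of small patterns on e, f and up to four fresh vertices; since
-- isolated vertices do not count, membership of a copy only depends on the pattern, and it is
-- decided by running through all labelings and orientations of the pattern.

module Submission where

open import Defs
open import Algebra.Bundles using (CommutativeMonoid)
open import Algebra.Properties.CommutativeSemigroup using (interchange)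
open import Data.Bool using (Bool; true; false; _∧_; _∨_; _xor_; not; if_then_else_)
open import Data.Bool.Properties
  using ( ∧-assoc; ∧-comm; ∨-comm; ∧-zeroʳ; ∧-identityʳ; ∧-distribʳ-∨; ∨-identityʳ; ∨-commutativeMonoid
        ; not-involutive; xor-comm)
open import Data.Fin using (Fin; zero; suc; _≟_; toℕ; splitAt; _↑ˡ_; _↑ʳ_; #_)
open import Data.Fin.Properties
  using (suc-injective; 0≢1+n; any?; pigeonhole; splitAt-↑ˡ; splitAt-↑ʳ; splitAt⁻¹-↑ˡ; splitAt⁻¹-↑ʳ)
import Data.Fin.Properties as Fin
open import Data.Fin.Subset using (Subset; _∪_; ⁅_⁆; _∈_; _⊆_) renaming (⊥ to ∅)
open import Data.Fin.Subset.Properties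
  using ( anySubset?; ⊆-reflexive; ⊆-trans; ⊆-antisym; p⊆p∪q; q⊆p∪q; x∈p∪q⁻; x∈⁅x⁆; x∈⁅y⁆⇒x≡y
        ; nonempty?; Empty-unique; ⊥⊆)
open import Data.Nat using (ℕ; zero; suc; _+_; _<_; _≤_; _≤?_; z≤n; s≤s)
open import Data.Nat.Properties using (+-suc; +-identityʳ; <-irrefl; <-asym; <⇒≤)
open import Data.Product using (_×_; _,_; proj₁; proj₂; ∃; swap; uncurry)
import Data.Product as Product
open import Data.Product.Properties using (,-injectiveˡ; ,-injectiveʳ; ×-≡,≡→≡; ≡-dec)
open import Data.Sum using (_⊎_; inj₁; inj₂; [_,_]′)
import Data.Sum as Sum
open import Data.Vec using (Vec; []; _∷_; lookup; _++_; tabulate)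
open import Data.Vec.Properties using (lookup∘tabulate; lookup-replicate; lookup-zipWith)
open import Data.Vec.Relation.Unary.All using (All; []; _∷_)
import Data.Vec.Relation.Unary.All as All
open import Data.Vec.Relation.Unary.AllPairs using ([]; _∷_)
open import Data.Vec.Relation.Unary.Unique.Propositional using (Unique)
open import Data.Vec.Relation.Unary.Unique.Propositional.Properties using (lookup-injective)
open import Data.Empty using (⊥-elim)
open import Relation.Nullary using (¬_; Dec; ¬?; _×-dec_; _⊎-dec_; _→-dec_; contradiction)
open import Function using (_∘_; id; Injective; _⇔_; mk⇔; Equivalence)
open import Relation.Nullary.Decidable using (⌊_⌋; does; yes; no; isYes≗does; dec-false; True; toWitness)
open import Relation.Binary.PropositionalEquality
  using (_≡_; _≢_; refl; sym; trans; cong; cong₂; subst; ≢-sym; module ≡-Reasoning)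

open ≡-Reasoning

-- Counting over Fin

cnt-cong : ∀ {m} {p q : Fin m → Bool} → (∀ i → p i ≡ q i) → cnt p ≡ cnt q
cnt-cong {zero}  p≗q = refl
cnt-cong {suc m} p≗q = cong₂ (λ b c → (if b then 1 else 0) + c) (p≗q zero) (cnt-cong (p≗q ∘ suc))

anyF-cong : ∀ {m} {p q : Fin m → Bool} → (∀ i → p i ≡ q i) → anyF p ≡ anyF q
anyF-cong {zero}  p≗q = refl
anyF-cong {suc m} p≗q = cong₂ _∨_ (p≗q zero) (anyF-cong (p≗q ∘ suc))

cnt-false : ∀ m → cnt {m} (λ _ → false) ≡ 0
cnt-false zero    = refl
cnt-false (suc m) = cnt-false m

anyF-false : ∀ m → anyF {m} (λ _ → false) ≡ false
anyF-false zero    = refl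
anyF-false (suc m) = anyF-false m

cnt-∨ : ∀ {m} (p q : Fin m → Bool) → (∀ i → p i ∧ q i ≡ false) →
        cnt (λ i → p i ∨ q i) ≡ cnt p + cnt q
cnt-∨ {zero}  p q disjoint = refl
cnt-∨ {suc m} p q disjoint
  with p zero | q zero | disjoint zero | cnt-∨ (p ∘ suc) (q ∘ suc) (disjoint ∘ suc)
... | true  | true  | () | _
... | true  | false | _  | ih = cong suc ih
... | false | true  | _  | ih = trans (cong suc ih) (sym (+-suc _ _))
... | false | false | _  | ih = ih

anyF-∨ : ∀ {m} (p q : Fin m → Bool) → anyF (λ i → p i ∨ q i) ≡ anyF p ∨ anyF q
anyF-∨ {zero}  p q = refl
anyF-∨ {suc m} p q = trans (cong ((p zero ∨ q zero) ∨_) (anyF-∨ (p ∘ suc) (q ∘ suc)))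
  (interchange (CommutativeMonoid.commutativeSemigroup ∨-commutativeMonoid) (p zero) (q zero) _ _)

anyF-∧ʳ : ∀ {m} (p : Fin m → Bool) b → anyF p ∧ b ≡ anyF (λ i → p i ∧ b)
anyF-∧ʳ {zero}  p b = refl
anyF-∧ʳ {suc m} p b =
  trans (∧-distribʳ-∨ b (p zero) (anyF (p ∘ suc))) (cong ((p zero ∧ b) ∨_) (anyF-∧ʳ (p ∘ suc) b))

anyF-swap : ∀ {k m} (p : Fin k → Fin m → Bool) →
            anyF (λ i → anyF (λ j → p i j)) ≡ anyF (λ j → anyF (λ i → p i j))
anyF-swap {zero}  {m} p = sym (anyF-false m)
anyF-swap {suc k} p = trans (cong (anyF (p zero) ∨_) (anyF-swap (p ∘ suc))) (sym (anyF-∨ (p zero) _))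

cnt-single : ∀ {m} (c : Fin m) (q : Fin m → Bool) → cnt (λ i → does (c ≟ i) ∧ q i) ≡ (if q c then 1 else 0)
cnt-single {suc m} zero    q = trans (cong ((if q zero then 1 else 0) +_) (cnt-false m)) (+-identityʳ _)
cnt-single {suc m} (suc c) q = cnt-single c (λ i → q (suc i))

anyF-single : ∀ {m} (c : Fin m) (q : Fin m → Bool) → anyF (λ i → does (c ≟ i) ∧ q i) ≡ q c
anyF-single {suc m} zero    q = trans (cong (q zero ∨_) (anyF-false m)) (∨-identityʳ _)
anyF-single {suc m} (suc c) q = anyF-single c (λ i → q (suc i))

imageOf : ∀ {k N} → (Fin k → Fin N) → (Fin k → Bool) → Fin N → Bool
imageOf φ u y = anyF (λ i → does (φ i ≟ y) ∧ u i)

imageOf-∉ : ∀ {k N} (φ : Fin k → Fin N) (u : Fin k → Bool) {y} → (∀ i → φ i ≢ y) →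
            imageOf φ u y ≡ false
imageOf-∉ {zero}  φ u φ≢y = refl
imageOf-∉ {suc k} φ u {y} φ≢y =
  cong₂ (λ b c → b ∧ u zero ∨ c) (dec-false (φ zero ≟ y) (φ≢y zero))
        (imageOf-∉ (λ i → φ (suc i)) (λ i → u (suc i)) (λ i → φ≢y (suc i)))

cnt-imageOf : ∀ {k N} (φ : Fin k → Fin N) → Injective _≡_ _≡_ φ → (u : Fin k → Bool) (q : Fin N → Bool) →
              cnt (λ y → imageOf φ u y ∧ q y) ≡ cnt (λ i → u i ∧ q (φ i))
cnt-imageOf {zero}  {N} φ φ-inj u q = cnt-false N
cnt-imageOf {suc k} φ φ-inj u q = begin
  cnt (λ y → imageOf φ u y ∧ q y)
    ≡⟨ cnt-cong (λ y → ∧-distribʳ-∨ (q y) (head y) (rest y)) ⟩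
  cnt (λ y → head y ∧ q y ∨ rest y ∧ q y)
    ≡⟨ cnt-∨ (λ y → head y ∧ q y) (λ y → rest y ∧ q y) disjoint ⟩
  cnt (λ y → head y ∧ q y) + cnt (λ y → rest y ∧ q y)
    ≡⟨ cong₂ _+_ (trans (cnt-cong (λ y → ∧-assoc (does (φ zero ≟ y)) (u zero) (q y)))
                        (cnt-single (φ zero) (λ y → u zero ∧ q y)))
                 (cnt-imageOf (λ i → φ (suc i)) (suc-injective ∘ φ-inj) (λ i → u (suc i)) q) ⟩
  cnt (λ i → u i ∧ q (φ i)) ∎
  where
  head : _ → Bool
  head y = does (φ zero ≟ y) ∧ u zero
  rest : _ → Bool
  rest = imageOf (λ i → φ (suc i)) (λ i → u (suc i))
  disjoint : ∀ y → (head y ∧ q y) ∧ (rest y ∧ q y) ≡ false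
  disjoint y with φ zero ≟ y
  ... | no _     = refl
  ... | yes refl = trans (cong (λ b → (u zero ∧ q (φ zero)) ∧ (b ∧ q (φ zero)))
                               (imageOf-∉ (λ i → φ (suc i)) (λ i → u (suc i))
                                          (λ i → 0≢1+n ∘ sym ∘ φ-inj)))
                         (∧-zeroʳ _)

anyF-imageOf : ∀ {k N} (φ : Fin k → Fin N) (u : Fin k → Bool) (q : Fin N → Bool) →
               anyF (λ y → imageOf φ u y ∧ q y) ≡ anyF (λ i → u i ∧ q (φ i))
anyF-imageOf φ u q = begin
  anyF (λ y → imageOf φ u y ∧ q y)
    ≡⟨ anyF-cong (λ y → anyF-∧ʳ (λ i → does (φ i ≟ y) ∧ u i) (q y)) ⟩
  anyF (λ y → anyF (λ i → (does (φ i ≟ y) ∧ u i) ∧ q y))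
    ≡⟨ anyF-swap (λ y i → (does (φ i ≟ y) ∧ u i) ∧ q y) ⟩
  anyF (λ i → anyF (λ y → (does (φ i ≟ y) ∧ u i) ∧ q y))
    ≡⟨ anyF-cong (λ i → trans (anyF-cong (λ y → ∧-assoc (does (φ i ≟ y)) (u i) (q y)))
                              (anyF-single (φ i) (λ y → u i ∧ q y))) ⟩
  anyF (λ i → u i ∧ q (φ i)) ∎

-- Off the image of φ the value is a junk default.
extend : ∀ {k N} → (Fin k → Fin N) → (Fin k → Bool) → Fin N → Bool
extend φ F y with any? (λ i → φ i ≟ y)
... | yes (i , _) = F i
... | no _        = false

extend-∘ : ∀ {k N} {φ : Fin k → Fin N} → Injective _≡_ _≡_ φ → ∀ F i → extend φ F (φ i) ≡ F i
extend-∘ {φ = φ} φ-inj F i with any? (λ j → φ j ≟ φ i)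
... | yes (j , φj≡φi) = cong F (φ-inj φj≡φi)
... | no none         = contradiction (i , refl) none

-- Edges and vertices

ends-↑ˡ : ∀ n (j : Fin n) → ends (suc n) (j ↑ˡ numE n) ≡ (zero , suc j)
ends-↑ˡ n j rewrite splitAt-↑ˡ n j (numE n) = refl

ends-↑ʳ : ∀ n (y : Fin (numE n)) → ends (suc n) (n ↑ʳ y) ≡ (suc (proj₁ (ends n y)) , suc (proj₂ (ends n y)))
ends-↑ʳ n y rewrite splitAt-↑ʳ n (numE n) y = refl

ends-< : ∀ n (y : Fin (numE n)) → toℕ (proj₁ (ends n y)) < toℕ (proj₂ (ends n y))
ends-< (suc n) y with splitAt n y
... | inj₁ _ = s≤s z≤n
... | inj₂ z = s≤s (ends-< n z)

ends-loopless : ∀ n (y : Fin (numE n)) → proj₁ (ends n y) ≢ proj₂ (ends n y)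
ends-loopless n y eq = <-irrefl (cong toℕ eq) (ends-< n y)

ends-injective : ∀ n {y y' : Fin (numE n)} → ends n y ≡ ends n y' → y ≡ y'
ends-injective (suc n) {y} {y'} eq with splitAt n y in ey | splitAt n y' in ey'
... | inj₁ i | inj₁ i' = trans (sym (splitAt⁻¹-↑ˡ ey))
  (trans (cong (_↑ˡ numE n) (suc-injective (,-injectiveʳ eq))) (splitAt⁻¹-↑ˡ ey'))
... | inj₂ z | inj₂ z' = trans (sym (splitAt⁻¹-↑ʳ ey))
  (trans (cong (n ↑ʳ_) (ends-injective n (×-≡,≡→≡ (suc-injective (,-injectiveˡ eq) ,
                                                    suc-injective (,-injectiveʳ eq)))))
         (splitAt⁻¹-↑ʳ ey'))
... | inj₁ _ | inj₂ _ = contradiction (,-injectiveˡ eq) 0≢1+n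
... | inj₂ _ | inj₁ _ = contradiction (sym (,-injectiveˡ eq)) 0≢1+n

SameEnds : ∀ {A : Set} → A × A → A × A → Set
SameEnds p q = p ≡ q ⊎ p ≡ swap q

sameEnds-from : ∀ {A : Set} {r p q : A × A} → SameEnds r p → SameEnds r q → SameEnds p q
sameEnds-from (inj₁ refl) r≈q = r≈q
sameEnds-from (inj₂ refl) (inj₁ refl) = inj₂ refl
sameEnds-from (inj₂ refl) (inj₂ refl) = inj₁ refl

sameEnds-injective : ∀ {A B : Set} {φ : A → B} → Injective _≡_ _≡_ φ → ∀ {a b c d} →
                     SameEnds (φ a , φ b) (φ c , φ d) → SameEnds (a , b) (c , d)
sameEnds-injective φ-inj = Sum.map pair-injective pair-injective
  where
  pair-injective : ∀ {a b c d} → (_ , _) ≡ (_ , _) → (a , b) ≡ (c , d)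
  pair-injective eq = ×-≡,≡→≡ (φ-inj (,-injectiveˡ eq) , φ-inj (,-injectiveʳ eq))

Joins : ∀ {n} → Fin (numE n) → Fin n → Fin n → Set
Joins {n} y u v = SameEnds (ends n y) (u , v)

joins-ends : ∀ {n} (y : Fin (numE n)) → Joins y (proj₁ (ends n y)) (proj₂ (ends n y))
joins-ends y = inj₁ refl

joins-sym : ∀ {n} {y : Fin (numE n)} {u v : Fin n} → Joins y u v → Joins y v u
joins-sym = Sum.swap

joins-unique : ∀ {n} {y y' : Fin (numE n)} {u v : Fin n} → Joins y u v → Joins y' u v → y ≡ y'
joins-unique {n} (inj₁ p) (inj₁ q) = ends-injective n (trans p (sym q))
joins-unique {n} (inj₂ p) (inj₂ q) = ends-injective n (trans p (sym q))
joins-unique {n} {y} {y'} (inj₁ p) (inj₂ q) = contradiction (ascending y p) (<-asym (ascending y' q))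
  where
  ascending : ∀ y {a b} → ends n y ≡ (a , b) → toℕ a < toℕ b
  ascending y p = subst (λ (a , b) → toℕ a < toℕ b) p (ends-< n y)
joins-unique (inj₂ p) (inj₁ q) = sym (joins-unique (inj₁ q) (inj₂ p))

joins-symmetric : ∀ {A : Set} {n} {y : Fin (numE n)} {u v : Fin n} (h : Fin n → Fin n → A) →
                  (∀ a b → h a b ≡ h b a) →
                  Joins y u v → h (proj₁ (ends n y)) (proj₂ (ends n y)) ≡ h u v
joins-symmetric h h-comm (inj₁ p) = cong (uncurry h) p
joins-symmetric h h-comm (inj₂ p) = trans (cong (uncurry h) p) (h-comm _ _)

edge-joining : ∀ {n} {u v : Fin n} → u ≢ v → ∃ λ y → Joins y u v
edge-joining {suc n} {zero}  {zero}  u≢v = contradiction refl u≢v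
edge-joining {suc n} {zero}  {suc j} u≢v = j ↑ˡ numE n , inj₁ (ends-↑ˡ n j)
edge-joining {suc n} {suc i} {zero}  u≢v = i ↑ˡ numE n , inj₂ (ends-↑ˡ n i)
edge-joining {suc n} {suc i} {suc j} u≢v with edge-joining (u≢v ∘ cong suc)
... | y , joins = n ↑ʳ y , Sum.map (lift y) (lift y) joins
  where
  lift : ∀ y {a b} → ends n y ≡ (a , b) → ends (suc n) (n ↑ʳ y) ≡ (suc a , suc b)
  lift y p = trans (ends-↑ʳ n y) (cong (λ (a , b) → suc a , suc b) p)

locate : ∀ {n k} (w : Fin n) (V : Vec (Fin n) k) → (∃ λ i → lookup V i ≡ w) ⊎ All (w ≢_) V
locate w []      = inj₂ []
locate w (v ∷ V) with v ≟ w
... | yes v≡w = inj₁ (zero , v≡w)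
... | no v≢w  = Sum.map (λ (i , eq) → suc i , eq) (≢-sym v≢w ∷_) (locate w V)

lookup-surjective⇒≮ : ∀ {n k} (V : Vec (Fin n) k) → (∀ w → ∃ λ i → lookup V i ≡ w) → ¬ (k < n)
lookup-surjective⇒≮ V occurs k<n with pigeonhole k<n (proj₁ ∘ occurs)
... | w , w' , w<w' , same = Fin.<-irrefl w≡w' w<w'
  where
  w≡w' : w ≡ w'
  w≡w' = trans (sym (proj₂ (occurs w))) (trans (cong (lookup V) same) (proj₂ (occurs w')))

fresh : ∀ {n k} (V : Vec (Fin n) k) → k < n → ∃ λ w → All (w ≢_) V
fresh V k<n with any? (λ w → All.all? (λ v → ¬? (w ≟ v)) V)
... | yes found = found
... | no none   = contradiction k<n (lookup-surjective⇒≮ V occurs)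
  where
  occurs : ∀ w → ∃ λ i → lookup V i ≡ w
  occurs w = [ id , (λ w∉V → contradiction (w , w∉V) none) ]′ (locate w V)

freshVertices : ∀ j {n k} {V : Vec (Fin n) k} → Unique V → j + k ≤ n →
                ∃ λ (U : Vec (Fin n) j) → Unique (U ++ V)
freshVertices zero    V! _       = [] , V!
freshVertices (suc j) V! j+k<n with freshVertices j V! (<⇒≤ j+k<n)
... | U , UV! with fresh (U ++ _) j+k<n
...   | w , w∉UV = w ∷ U , w∉UV ∷ UV!

unique₂ : ∀ {A : Set} {a b : A} → a ≢ b → Unique (a ∷ b ∷ [])
unique₂ a≢b = (a≢b ∷ []) ∷ [] ∷ []

unique₃ : ∀ {A : Set} {a b c : A} → a ≢ b → a ≢ c → b ≢ c → Unique (a ∷ b ∷ c ∷ [])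
unique₃ a≢b a≢c b≢c = (a≢b ∷ a≢c ∷ []) ∷ unique₂ b≢c

unique₄ : ∀ {A : Set} {a b c d : A} → a ≢ b → a ≢ c → a ≢ d → b ≢ c → b ≢ d → c ≢ d →
          Unique (a ∷ b ∷ c ∷ d ∷ [])
unique₄ a≢b a≢c a≢d b≢c b≢d c≢d = (a≢b ∷ a≢c ∷ a≢d ∷ []) ∷ unique₃ b≢c b≢d c≢d

data Meeting {n} (e f : Fin (numE n)) : Set where
  disjoint : ∀ {a b c d : Fin n} → Joins e a b → Joins f c d → Unique (a ∷ b ∷ c ∷ d ∷ []) → Meeting e f
  adjacent : ∀ {a b c : Fin n} → Joins e a b → Joins f a c → Unique (a ∷ b ∷ c ∷ []) → Meeting e f

meeting : ∀ {n} {e f : Fin (numE n)} → f ≢ e → Meeting {n} e f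
meeting {n} {e} {f} f≢e = classify (joins-ends e) (joins-ends f) (ends-loopless n e) (ends-loopless n f)
  where
  classify : ∀ {a b c d : Fin n} → Joins e a b → Joins f c d → a ≢ b → c ≢ d → Meeting e f
  classify {a} {b} {c} {d} je jf a≢b c≢d with c ≟ a | c ≟ b | d ≟ a | d ≟ b
  ... | yes refl | _        | _        | yes refl = contradiction (joins-unique jf je) f≢e
  ... | _        | yes refl | yes refl | _        = contradiction (joins-unique (joins-sym jf) je) f≢e
  ... | yes refl | _        | _        | no d≢b   = adjacent je jf (unique₃ a≢b c≢d (≢-sym d≢b))
  ... | _        | yes refl | no d≢a   | _        =
    adjacent (joins-sym je) jf (unique₃ (≢-sym a≢b) c≢d (≢-sym d≢a))
  ... | no c≢a   | no c≢b   | yes refl | _        =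
    adjacent je (joins-sym jf) (unique₃ a≢b (≢-sym c≢a) (≢-sym c≢b))
  ... | no c≢a   | no c≢b   | _        | yes refl =
    adjacent (joins-sym je) (joins-sym jf) (unique₃ (≢-sym a≢b) (≢-sym c≢b) (≢-sym c≢a))
  ... | no c≢a   | no c≢b   | no d≢a   | no d≢b   =
    disjoint je jf (unique₄ a≢b (≢-sym c≢a) (≢-sym d≢a) (≢-sym c≢b) (≢-sym d≢b) c≢d)

-- Linear operators

∈⇒⁅⁆⊆ : ∀ {N} {x : Fin N} {p : Subset N} → x ∈ p → ⁅ x ⁆ ⊆ p
∈⇒⁅⁆⊆ {x = x} {p} x∈p y∈⁅x⁆ = subst (_∈ p) (sym (x∈⁅y⁆⇒x≡y x y∈⁅x⁆)) x∈p

⊆⇒∪≡ : ∀ {N} {p q : Subset N} → p ⊆ q → p ∪ q ≡ q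
⊆⇒∪≡ {p = p} {q} p⊆q =
  ⊆-antisym (λ x∈p∪q → [ p⊆q , id ]′ (x∈p∪q⁻ p q x∈p∪q)) (q⊆p∪q p q)

_⊻_ : Set → Set → Set
A ⊻ B = (A × ¬ B) ⊎ (¬ A × B)

_⊻?_ : ∀ {A B : Set} → Dec A → Dec B → Dec (A ⊻ B)
a? ⊻? b? = (a? ×-dec ¬? b?) ⊎-dec (¬? a? ×-dec b?)

⊻-map : ∀ {A A' B B' : Set} → A ⇔ A' → B ⇔ B' → A' ⊻ B' → A ⊻ B
⊻-map A⇔A' B⇔B' = Sum.map (Product.map (from A⇔A') (_∘ to B⇔B')) (Product.map (_∘ to A⇔A') (from B⇔B'))
  where open Equivalence

Detects : ∀ {n} → (Graph n → Set) → Fin (numE n) → Graph n → Set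
Detects Z f Y = Z (⁅ f ⁆ ∪ Y) ⊻ Z Y

record Detectable {n} (Z : Graph n → Set) : Set where
  field
    detect        : ∀ e → ∃ λ X → Detects {n} Z e X
    detect-beside : ∀ e f → f ≢ e → ∃ λ Y → e ∈ Y × Detects {n} Z f Y

module _ {n} {L : Graph n → Graph n} (linear : IsLinear {n} L) where

  monotone : ∀ {A B} → A ⊆ B → L A ⊆ L B
  monotone {A} {B} A⊆B =
    subst (L A ⊆_) (trans (sym (proj₁ linear A B)) (cong L (⊆⇒∪≡ A⊆B))) (p⊆p∪q (L B))

  images-differ : ∀ {Z A B} → StronglyPreserves {n} Z L → Z A ⊻ Z B → L A ≢ L B
  images-differ {Z} {A} {B} (pres , pres¬) (inj₁ (za , ¬zb)) eq = pres¬ B ¬zb (subst Z eq (pres A za))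
  images-differ {Z} {A} {B} (pres , pres¬) (inj₂ (¬za , zb)) eq = pres¬ A ¬za (subst Z (sym eq) (pres B zb))

  detects⇒⊈ : ∀ {Z f Y} → StronglyPreserves {n} Z L → Detects {n} Z f Y → ¬ (L ⁅ f ⁆ ⊆ L Y)
  detects⇒⊈ {f = f} {Y} sp det Lf⊆LY =
    images-differ sp det (trans (proj₁ linear ⁅ f ⁆ Y) (⊆⇒∪≡ Lf⊆LY))

  singleton-image : ∀ {Z} → Idempotent {n} L → StronglyPreserves {n} Z L → Detectable {n} Z →
                    ∀ e → L ⁅ e ⁆ ≡ ⁅ e ⁆
  singleton-image idempotent sp detectable e = ⊆-antisym image⊆⁅e⁆ ⁅e⁆⊆image
    where
    open Detectable detectable

    image⊆⁅e⁆ : L ⁅ e ⁆ ⊆ ⁅ e ⁆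
    image⊆⁅e⁆ {f} f∈image with f ≟ e
    ... | yes refl = x∈⁅x⁆ f
    ... | no f≢e with detect-beside e f f≢e
    ...   | Y , e∈Y , det = ⊥-elim (detects⇒⊈ sp det
              (⊆-trans (monotone (∈⇒⁅⁆⊆ f∈image))
                       (⊆-trans (⊆-reflexive (idempotent ⁅ e ⁆)) (monotone (∈⇒⁅⁆⊆ e∈Y)))))

    ⁅e⁆⊆image : ⁅ e ⁆ ⊆ L ⁅ e ⁆
    ⁅e⁆⊆image with nonempty? (L ⁅ e ⁆) | detect e
    ... | yes (f , f∈image) | _       =
      ∈⇒⁅⁆⊆ (subst (_∈ L ⁅ e ⁆) (x∈⁅y⁆⇒x≡y e (image⊆⁅e⁆ f∈image)) f∈image)
    ... | no empty          | X , det =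
      ⊥-elim (detects⇒⊈ sp det (subst (_⊆ L X) (sym (Empty-unique empty)) ⊥⊆))

-- Patterns and their copies

sameEnds? : ∀ {N} (p q : Fin N × Fin N) → Dec (SameEnds p q)
sameEnds? p q = ≡-dec _≟_ _≟_ p q ⊎-dec ≡-dec _≟_ _≟_ p (swap q)

close? : ∀ a b → Dec (close a b)
close? a b = (a ≤? suc b) ×-dec (b ≤? suc a)

Z3Friendly : (Lab → ℕ) → Set
Z3Friendly c = close (c neg) (c zer) × close (c zer) (c pos) × close (c neg) (c pos)

z3Friendly? : ∀ c → Dec (Z3Friendly c)
z3Friendly? c = close? _ _ ×-dec close? _ _ ×-dec close? _ _

Z3Friendly-≡ : ∀ {c c'} → (∀ l → c l ≡ c' l) → Z3Friendly c ≡ Z3Friendly c'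
Z3Friendly-≡ c≗c' = cong₂ _×_ (cong₂ close (c≗c' neg) (c≗c' zer))
                       (cong₂ _×_ (cong₂ close (c≗c' zer) (c≗c' pos)) (cong₂ close (c≗c' neg) (c≗c' pos)))

arc : Bool → Bool → Bool → Lab
arc true  a b = diffLab a b
arc false a b = diffLab b a

module Pattern {K m : ℕ} (P : Vec (Fin K × Fin K) m) where

  src tgt : Fin m → Fin K
  src i = proj₁ (lookup P i)
  tgt i = proj₂ (lookup P i)

  Loopless : Set
  Loopless = ∀ i → src i ≢ tgt i

  Distinct : Set
  Distinct = ∀ i j → SameEnds (lookup P i) (lookup P j) → i ≡ j

  simple? : Dec (Loopless × Distinct)
  simple? = Fin.all? (λ i → ¬? (src i ≟ tgt i))
      ×-dec Fin.all? (λ i → Fin.all? (λ j → sameEnds? (lookup P i) (lookup P j) →-dec (i ≟ j)))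

  covered : Fin K → Bool
  covered j = anyF (λ i → does (src i ≟ j) ∨ does (tgt i ≟ j))

  VertexFriendly : (Fin K → Bool) → Set
  VertexFriendly F = close (cnt (λ j → covered j ∧ not (F j))) (cnt (λ j → covered j ∧ F j))

  EdgeFriendly : (Fin m → Bool) → Set
  EdgeFriendly g = close (cnt (λ i → not (g i))) (cnt g)

  arcCount : (Fin m → Bool) → (Fin K → Bool) → Lab → ℕ
  arcCount O F l = cnt (λ i → labEq (arc (O i) (F (src i)) (F (tgt i))) l)

  Cordial : (Bool → Bool → Bool) → Set
  Cordial op = ∃ λ (F : Subset K) →
    VertexFriendly (lookup F) × EdgeFriendly (λ i → op (lookup F (src i)) (lookup F (tgt i)))

  Orientable : Set
  Orientable = ∃ λ (O : Subset m) → ∃ λ (F : Subset K) →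
    VertexFriendly (lookup F) × Z3Friendly (arcCount (lookup O) (lookup F))

  cordial? : ∀ op → Dec (Cordial op)
  cordial? op = anySubset? (λ F → close? _ _ ×-dec close? _ _)

  orientable? : Dec Orientable
  orientable? = anySubset? (λ O → anySubset? (λ F → close? _ _ ×-dec z3Friendly? (arcCount (lookup O) (lookup F))))

range : ∀ {m N} → (Fin m → Fin N) → Subset N
range {zero}  ψ = ∅
range {suc m} ψ = ⁅ ψ zero ⁆ ∪ range (λ i → ψ (suc i))

∈-range : ∀ {m N} (ψ : Fin m → Fin N) i → ψ i ∈ range ψ
∈-range ψ zero    = p⊆p∪q _ (x∈⁅x⁆ (ψ zero))
∈-range ψ (suc i) = q⊆p∪q ⁅ ψ zero ⁆ _ (∈-range (λ i → ψ (suc i)) i)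

lookup-⁅⁆ : ∀ {N} (c y : Fin N) → lookup ⁅ c ⁆ y ≡ does (c ≟ y)
lookup-⁅⁆ zero    zero    = refl
lookup-⁅⁆ zero    (suc y) = lookup-replicate y false
lookup-⁅⁆ (suc c) zero    = refl
lookup-⁅⁆ (suc c) (suc y) = lookup-⁅⁆ c y

lookup-range : ∀ {m N} (ψ : Fin m → Fin N) y → lookup (range ψ) y ≡ imageOf ψ (λ _ → true) y
lookup-range {zero}  ψ y = lookup-replicate y false
lookup-range {suc m} ψ y = trans (lookup-zipWith _∨_ y ⁅ ψ zero ⁆ (range (λ i → ψ (suc i))))
  (cong₂ _∨_ (trans (lookup-⁅⁆ (ψ zero) y) (sym (∧-identityʳ _))) (lookup-range (λ i → ψ (suc i)) y))

-- Z2AddCordial and Z2MulCordial are Z2Cordial _xor_ and Z2Cordial _∧_ by definition.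
Z2Cordial : (Bool → Bool → Bool) → ∀ {n} → Graph n → Set
Z2Cordial op {n} G = ∃ λ (f : Fin n → Bool) → friendlyV {n} G f ×
  friendlyE {n} G (λ e → op (f (proj₁ (ends n e))) (f (proj₂ (ends n e))))

-- Turns the orientation flag of y used by arcLab (relative to ends n y) into one relative to the order u, v.
orient : ∀ {n} {y : Fin (numE n)} {u v : Fin n} → Joins y u v → Bool → Bool
orient (inj₁ _) b = b
orient (inj₂ _) b = not b

orient-involutive : ∀ {n} {y : Fin (numE n)} {u v : Fin n} (j : Joins y u v) b → orient j (orient j b) ≡ b
orient-involutive (inj₁ _) b = refl
orient-involutive (inj₂ _) b = not-involutive b

arcLab≡arc : ∀ {n} (o : Fin (numE n) → Bool) (f : Fin n → Bool) y →
             arcLab {n} o f y ≡ arc (o y) (f (proj₁ (ends n y))) (f (proj₂ (ends n y)))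
arcLab≡arc o f y with o y
... | true  = refl
... | false = refl

arc-cong : ∀ {b b' x x' y y'} → b ≡ b' → x ≡ x' → y ≡ y' → arc b x y ≡ arc b' x' y'
arc-cong refl refl refl = refl

arc-flip : ∀ b x y → arc (not b) x y ≡ arc b y x
arc-flip true  x y = refl
arc-flip false x y = refl

arcLab-joins : ∀ {n} (o : Fin (numE n) → Bool) (f : Fin n → Bool) {y : Fin (numE n)} {u v : Fin n}
               (j : Joins y u v) →
               arcLab {n} o f y ≡ arc (orient j (o y)) (f u) (f v)
arcLab-joins o f {y} (inj₁ p) = trans (arcLab≡arc o f y) (cong (λ (a , b) → arc (o y) (f a) (f b)) p)
arcLab-joins o f {y} (inj₂ p) =
  trans (arcLab≡arc o f y) (trans (cong (λ (a , b) → arc (o y) (f a) (f b)) p) (sym (arc-flip (o y) _ _)))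

module Embedding {n K} {W : Vec (Fin n) K} (W! : Unique W) where

  φ : Fin K → Fin n
  φ = lookup W

  φ-injective : Injective _≡_ _≡_ φ
  φ-injective = lookup-injective W! _ _

  module _ {m} (P : Vec (Fin K × Fin K) m) (loopless : Pattern.Loopless P) where
    open Pattern P

    ψ : Fin m → Fin (numE n)
    ψ i = proj₁ (edge-joining (loopless i ∘ φ-injective))

    ψ-joins : ∀ i → Joins (ψ i) (φ (src i)) (φ (tgt i))
    ψ-joins i = proj₂ (edge-joining (loopless i ∘ φ-injective))

    image : Graph n
    image = range ψ

    ∈-image : ∀ i {e} → Joins e (φ (src i)) (φ (tgt i)) → e ∈ image
    ∈-image i je = subst (_∈ image) (joins-unique (ψ-joins i) je) (∈-range ψ i)

    nonIso-image : ∀ v → nonIso {n} image v ≡ imageOf φ covered v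
    nonIso-image v = begin
      anyF (λ y → lookup image y ∧ touches y)
        ≡⟨ anyF-cong (λ y → cong (_∧ touches y) (lookup-range ψ y)) ⟩
      anyF (λ y → imageOf ψ (λ _ → true) y ∧ touches y)
        ≡⟨ anyF-imageOf ψ (λ _ → true) touches ⟩
      anyF (λ i → touches (ψ i))
        ≡⟨ anyF-cong (λ i → trans (joins-symmetric (λ a b → ⌊ a ≟ v ⌋ ∨ ⌊ b ≟ v ⌋)
                                                   (λ a b → ∨-comm ⌊ a ≟ v ⌋ ⌊ b ≟ v ⌋) (ψ-joins i))
                                  (cong₂ _∨_ (isYes≗does (φ (src i) ≟ v)) (isYes≗does (φ (tgt i) ≟ v)))) ⟩
      anyF (λ i → does (φ (src i) ≟ v) ∨ does (φ (tgt i) ≟ v))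
        ≡⟨ anyF-cong (λ i → sym (cong₂ _∨_ (anyF-single (src i) hits) (anyF-single (tgt i) hits))) ⟩
      anyF (λ i → anyF (λ j → does (src i ≟ j) ∧ hits j) ∨ anyF (λ j → does (tgt i ≟ j) ∧ hits j))
        ≡⟨ anyF-cong (λ i → sym (trans (anyF-cong (λ j → ∧-distribʳ-∨ (hits j) (does (src i ≟ j)) (does (tgt i ≟ j))))
                                        (anyF-∨ (λ j → does (src i ≟ j) ∧ hits j) (λ j → does (tgt i ≟ j) ∧ hits j)))) ⟩
      anyF (λ i → anyF (λ j → (does (src i ≟ j) ∨ does (tgt i ≟ j)) ∧ hits j))
        ≡⟨ anyF-swap (λ i j → (does (src i ≟ j) ∨ does (tgt i ≟ j)) ∧ hits j) ⟩
      anyF (λ j → anyF (λ i → (does (src i ≟ j) ∨ does (tgt i ≟ j)) ∧ hits j))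
        ≡⟨ anyF-cong (λ j → sym (anyF-∧ʳ (λ i → does (src i ≟ j) ∨ does (tgt i ≟ j)) (hits j))) ⟩
      anyF (λ j → covered j ∧ hits j)
        ≡⟨ anyF-cong (λ j → ∧-comm (covered j) (hits j)) ⟩
      imageOf φ covered v ∎
      where
      touches : Fin (numE n) → Bool
      touches y = ⌊ proj₁ (ends n y) ≟ v ⌋ ∨ ⌊ proj₂ (ends n y) ≟ v ⌋
      hits : Fin K → Bool
      hits j = does (φ j ≟ v)

    module _ (distinct : Distinct) where

      ψ-injective : Injective _≡_ _≡_ ψ
      ψ-injective {i} {j} ψi≡ψj = distinct i j (sameEnds-injective φ-injective
        (sameEnds-from (ψ-joins i) (subst (λ y → Joins y (φ (src j)) (φ (tgt j))) (sym ψi≡ψj) (ψ-joins j))))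

      edge-count : ∀ g → cnt (λ y → hasEdge {n} image y ∧ g y) ≡ cnt (λ i → g (ψ i))
      edge-count g =
        trans (cnt-cong (λ y → cong (_∧ g y) (lookup-range ψ y))) (cnt-imageOf ψ ψ-injective (λ _ → true) g)

      vertex-count : ∀ {F : Fin K → Bool} {f : Fin n → Bool} → (∀ j → F j ≡ f (φ j)) → (q : Bool → Bool) →
                     cnt (λ v → nonIso {n} image v ∧ q (f v)) ≡ cnt (λ j → covered j ∧ q (F j))
      vertex-count {F} {f} F≗fφ q = begin
        cnt (λ v → nonIso image v ∧ q (f v))   ≡⟨ cnt-cong (λ v → cong (_∧ q (f v)) (nonIso-image v)) ⟩
        cnt (λ v → imageOf φ covered v ∧ q (f v)) ≡⟨ cnt-imageOf φ φ-injective covered (q ∘ f) ⟩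
        cnt (λ j → covered j ∧ q (f (φ j)))      ≡⟨ cnt-cong (λ j → cong (λ b → covered j ∧ q b) (sym (F≗fφ j))) ⟩
        cnt (λ j → covered j ∧ q (F j))          ∎

      friendlyV-≡ : ∀ {F : Fin K → Bool} {f : Fin n → Bool} → (∀ j → F j ≡ f (φ j)) →
                    friendlyV {n} image f ≡ VertexFriendly F
      friendlyV-≡ {F} {f} F≗fφ = cong₂ close (vertex-count {F} {f} F≗fφ not) (vertex-count {F} {f} F≗fφ id)

      friendlyE-≡ : ∀ {h : Fin m → Bool} {g : Fin (numE n) → Bool} → (∀ i → h i ≡ g (ψ i)) →
                    friendlyE {n} image g ≡ EdgeFriendly h
      friendlyE-≡ {h} {g} h≗gψ = cong₂ close
        (trans (edge-count (not ∘ g)) (cnt-cong (λ i → cong not (sym (h≗gψ i)))))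
        (trans (edge-count g) (cnt-cong (sym ∘ h≗gψ)))

      module _ (op : Bool → Bool → Bool) (op-comm : ∀ a b → op a b ≡ op b a) where

        cordialBy-≡ : ∀ {F : Fin K → Bool} {f : Fin n → Bool} → (∀ j → F j ≡ f (φ j)) →
          (friendlyV {n} image f × friendlyE {n} image (λ e → op (f (proj₁ (ends n e))) (f (proj₂ (ends n e)))))
            ≡ (VertexFriendly F × EdgeFriendly (λ i → op (F (src i)) (F (tgt i))))
        cordialBy-≡ {F} {f} F≗fφ = cong₂ _×_ (friendlyV-≡ F≗fφ) (friendlyE-≡ λ i →
          trans (cong₂ op (F≗fφ (src i)) (F≗fφ (tgt i)))
                (sym (joins-symmetric (λ a b → op (f a) (f b)) (λ a b → op-comm (f a) (f b)) (ψ-joins i))))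

        cordial⇔ : Z2Cordial op {n} image ⇔ Cordial op
        cordial⇔ = mk⇔
          (λ (f , friendly) → tabulate (f ∘ φ) , subst id (cordialBy-≡ (lookup∘tabulate (f ∘ φ))) friendly)
          (λ (F , friendly) → extend φ (lookup F) ,
             subst id (sym (cordialBy-≡ (sym ∘ extend-∘ φ-injective (lookup F)))) friendly)

      orientableBy-≡ : ∀ {O : Fin m → Bool} {F : Fin K → Bool} {o : Fin (numE n) → Bool} {f : Fin n → Bool} →
        (∀ i → O i ≡ orient (ψ-joins i) (o (ψ i))) → (∀ j → F j ≡ f (φ j)) →
        (friendlyV {n} image f × Z3Friendly (cntLab {n} image (arcLab {n} o f)))
          ≡ (VertexFriendly F × Z3Friendly (arcCount O F))
      orientableBy-≡ {O} {F} {o} {f} O≗oψ F≗fφ = cong₂ _×_ (friendlyV-≡ F≗fφ) (Z3Friendly-≡ λ l →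
        trans (edge-count (λ y → labEq (arcLab o f y) l)) (cnt-cong λ i → cong (λ a → labEq a l)
          (trans (arcLab-joins o f (ψ-joins i)) (sym (arc-cong (O≗oψ i) (F≗fφ (src i)) (F≗fφ (tgt i)))))))

      orientable⇔ : Orientable23 {n} image ⇔ Orientable
      orientable⇔ = mk⇔
        (λ (o , f , friendly) → tabulate (λ i → orient (ψ-joins i) (o (ψ i))) , tabulate (f ∘ φ) ,
           subst id (orientableBy-≡ {o = o} {f} (lookup∘tabulate _) (lookup∘tabulate (f ∘ φ))) friendly)
        (λ (O , F , friendly) → reoriented O , extend φ (lookup F) ,
           subst id (sym (orientableBy-≡ {o = reoriented O} (reorient O) (sym ∘ extend-∘ φ-injective (lookup F))))
                    friendly)
        where
        reoriented : Subset m → Fin (numE n) → Bool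
        reoriented O = extend ψ (λ i → orient (ψ-joins i) (lookup O i))
        reorient : ∀ O i → lookup O i ≡ orient (ψ-joins i) (reoriented O (ψ i))
        reorient O i =
          sym (trans (cong (orient (ψ-joins i)) (extend-∘ ψ-injective _ i)) (orient-involutive (ψ-joins i) _))

record PatternDecidable (Z : ∀ {n} → Graph n → Set) : Set₁ where
  field
    Model   : ∀ {K m} → Vec (Fin K × Fin K) m → Set
    model?  : ∀ {K m} (P : Vec (Fin K × Fin K) m) → Dec (Model P)
    image-⇔ : ∀ {n K m} {W : Vec (Fin n) K} (W! : Unique W) {P : Vec (Fin K × Fin K) m}
              (loopless : Pattern.Loopless P) → Pattern.Distinct P → Z {n} (Embedding.image W! P loopless) ⇔ Model P

z2Cordial-patterns : ∀ op → (∀ a b → op a b ≡ op b a) → PatternDecidable (λ {n} → Z2Cordial op {n})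
z2Cordial-patterns op op-comm = record
  { Model   = λ P → Pattern.Cordial P op
  ; model?  = λ P → Pattern.cordial? P op
  ; image-⇔ = λ W! {P} loopless distinct → Embedding.cordial⇔ W! P loopless distinct op op-comm
  }

orientable-patterns : PatternDecidable (λ {n} → Orientable23 {n})
orientable-patterns = record
  { Model   = Pattern.Orientable
  ; model?  = Pattern.orientable?
  ; image-⇔ = λ W! {P} loopless distinct → Embedding.orientable⇔ W! P loopless distinct
  }

module _ {Z : ∀ {n} → Graph n → Set} (patterns : PatternDecidable (λ {n} → Z {n})) where
  open PatternDecidable patterns

  -- The implicit proofs are found by evaluating the decision procedures on the concrete pattern.
  module _ {n K m} {W : Vec (Fin n) K} (W! : Unique W) (q : Fin K × Fin K) (P : Vec (Fin K × Fin K) m)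
           {simple : True (Pattern.simple? (q ∷ P))} {separated : True (model? (q ∷ P) ⊻? model? P)} where

    private
      loopless : Pattern.Loopless (q ∷ P)
      loopless = proj₁ (toWitness simple)
      distinct : Pattern.Distinct (q ∷ P)
      distinct = proj₂ (toWitness simple)
      Y : Graph n
      Y = Embedding.image W! P (λ i → loopless (suc i))

    pattern-detects : ∀ {f} → Joins f (lookup W (proj₁ q)) (lookup W (proj₂ q)) → Detects {n} (Z {n}) f Y
    pattern-detects jf =
      subst (λ f → Detects {n} (Z {n}) f Y) (joins-unique (Embedding.ψ-joins W! (q ∷ P) loopless zero) jf)
      (⊻-map (image-⇔ {n} W! {q ∷ P} loopless distinct)
             (image-⇔ {n} W! {P} (λ i → loopless (suc i)) (λ i j → suc-injective ∘ distinct (suc i) (suc j)))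
             (toWitness separated))

    pattern-detects-beside : ∀ i {e f} → Joins e (lookup W (Pattern.src P i)) (lookup W (Pattern.tgt P i)) →
                             Joins f (lookup W (proj₁ q)) (lookup W (proj₂ q)) →
                             ∃ λ Y → e ∈ Y × Detects {n} (Z {n}) f Y
    pattern-detects-beside i je jf = Y , Embedding.∈-image W! P (λ i → loopless (suc i)) i je , pattern-detects jf

-- Detecting graphs

-- The vertex list W of a copy starts with the fresh vertices, followed by the ends of e (and f).
z2AddCordial-detectable : ∀ {n} → 4 ≤ n → Detectable {n} (Z2AddCordial {n})
z2AddCordial-detectable {n} 4≤n = record { detect = detect ; detect-beside = detect-beside }
  where
  patterns : PatternDecidable (λ {n} → Z2Cordial _xor_ {n})
  patterns = z2Cordial-patterns _xor_ xor-comm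

  detect : ∀ e → ∃ λ X → Detects {n} (Z2AddCordial {n}) e X
  detect e with freshVertices 2 (unique₂ (ends-loopless n e)) 4≤n
  ... | _ ∷ _ ∷ [] , W! = _ , pattern-detects patterns W! (# 2 , # 3) ((# 0 , # 1) ∷ []) (joins-ends e)

  detect-beside : ∀ e f → f ≢ e → ∃ λ Y → e ∈ Y × Detects {n} (Z2AddCordial {n}) f Y
  detect-beside e f f≢e with meeting {n} f≢e
  ... | disjoint je jf W! = pattern-detects-beside patterns W! (# 2 , # 3) ((# 0 , # 1) ∷ []) (# 0) je jf
  ... | adjacent je jf abc! with freshVertices 1 abc! 4≤n
  ...   | _ ∷ [] , W! = pattern-detects-beside patterns W! (# 1 , # 3) ((# 1 , # 2) ∷ (# 3 , # 0) ∷ []) (# 0) je jf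

z2MulCordial-detectable : ∀ {n} → 4 ≤ n → Detectable {n} (Z2MulCordial {n})
z2MulCordial-detectable {n} 4≤n = record { detect = detect ; detect-beside = detect-beside }
  where
  patterns : PatternDecidable (λ {n} → Z2Cordial _∧_ {n})
  patterns = z2Cordial-patterns _∧_ ∧-comm

  detect : ∀ e → ∃ λ X → Detects {n} (Z2MulCordial {n}) e X
  detect e with freshVertices 2 (unique₂ (ends-loopless n e)) 4≤n
  ... | _ ∷ _ ∷ [] , W! =
    _ , pattern-detects patterns W! (# 2 , # 3) ((# 2 , # 0) ∷ (# 2 , # 1) ∷ (# 3 , # 0) ∷ []) (joins-ends e)

  detect-beside : ∀ e f → f ≢ e → ∃ λ Y → e ∈ Y × Detects {n} (Z2MulCordial {n}) f Y
  detect-beside e f f≢e with meeting {n} f≢e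
  ... | disjoint je jf W! =
    pattern-detects-beside patterns W! (# 2 , # 3) ((# 0 , # 1) ∷ (# 0 , # 2) ∷ (# 0 , # 3) ∷ []) (# 0) je jf
  ... | adjacent je jf abc! with freshVertices 1 abc! 4≤n
  ...   | _ ∷ [] , W! =
    pattern-detects-beside patterns W! (# 1 , # 3) ((# 1 , # 2) ∷ (# 2 , # 3) ∷ (# 2 , # 0) ∷ []) (# 0) je jf

orientable23-detectable : ∀ {n} → 6 ≤ n → Detectable {n} (Orientable23 {n})
orientable23-detectable {n} 6≤n = record { detect = detect ; detect-beside = detect-beside }
  where
  detect : ∀ e → ∃ λ X → Detects {n} (Orientable23 {n}) e X
  detect e with freshVertices 4 (unique₂ (ends-loopless n e)) 6≤n
  ... | _ ∷ _ ∷ _ ∷ _ ∷ [] , W! =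
    _ , pattern-detects orientable-patterns W! (# 4 , # 5) ((# 0 , # 1) ∷ (# 2 , # 3) ∷ []) (joins-ends e)

  detect-beside : ∀ e f → f ≢ e → ∃ λ Y → e ∈ Y × Detects {n} (Orientable23 {n}) f Y
  detect-beside e f f≢e with meeting {n} f≢e
  ... | disjoint je jf abcd! with freshVertices 2 abcd! 6≤n
  ...   | _ ∷ _ ∷ [] , W! =
    pattern-detects-beside orientable-patterns W! (# 4 , # 5) ((# 2 , # 3) ∷ (# 0 , # 1) ∷ []) (# 0) je jf
  detect-beside e f f≢e | adjacent je jf abc! with freshVertices 3 abc! 6≤n
  ...   | _ ∷ _ ∷ _ ∷ [] , W! =
    pattern-detects-beside orientable-patterns W! (# 3 , # 5) ((# 3 , # 4) ∷ (# 5 , # 0) ∷ (# 1 , # 2) ∷ [])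
                           (# 0) je jf

mainTheorem3 : (n : ℕ) (L : Graph n → Graph n) → IsLinear {n} L → Idempotent {n} L →
    ((4 ≤ n × StronglyPreserves {n} (Z2AddCordial {n}) L)
      ⊎ (4 ≤ n × StronglyPreserves {n} (Z2MulCordial {n}) L)
      ⊎ (6 ≤ n × StronglyPreserves {n} (Orientable23 {n}) L)) →
    (e : Fin (numE n)) → ∃ λ (e' : Fin (numE n)) → L ⁅ e ⁆ ≡ ⁅ e' ⁆
mainTheorem3 n L linear idempotent (inj₁ (4≤n , preserves)) e =
  e , singleton-image linear idempotent preserves (z2AddCordial-detectable 4≤n) e
mainTheorem3 n L linear idempotent (inj₂ (inj₁ (4≤n , preserves))) e =
  e , singleton-image linear idempotent preserves (z2MulCordial-detectable 4≤n) e
mainTheorem3 n L linear idempotent (inj₂ (inj₂ (6≤n , preserves))) e =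
  e , singleton-image linear idempotent preserves (orientable23-detectable 6≤n) e
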